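{- Let $G$ be a digraph on $V=[n]$. Suppose there is a sequence of digraphs $G\subseteq G_1\subseteq\cdots\subseteq G_k=K_n^\circ$ on $V$, where $K_n^\circ$ is the complete digraph on $[n]$ with all loops (arc set $[n]\times[n]$), such that $G_1$ is obtained from $G_0:=G$ and each $G_{t+1}$ is obtained from $G_t$ by adding arcs each of which is admissible for $G_t$ in the following sense: an arc $(j,k)$ is admissible for $G_t$ if there is $i\in V$ with $N^+_G[i]\cap(V\setminus N^+_{G_t}[j])=\{k\}$ and $N^-_G[j]\cap(V\setminus N^-_{G_t}[i])=\emptyset$; an arc $(m,i)$ is admissible for $G_t$ if there is $j\in V$ with $N^+_G[i]\cap(V\setminus N^+_{G_t}[j])=\emptyset$ and $N^-_G[j]\cap(V\setminus N^-_{G_t}[i])=\{m\}$. Then $G$ requires the nSSP.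
   Context: A digraph $G$ has vertex set $[n]$ and arc set $E(G)\subseteq[n]\times[n]$ (arcs $(v,v)$ are loops); $G\subseteq H$ means $E(G)\subseteq E(H)$. $N^+_G[v]=\{u:(v,u)\in E(G)\}$ and $N^-_G[v]=\{w:(w,v)\in E(G)\}$. $\mathcal M(G)$ is the set of real $n\times n$ matrices $A=(a_{ij})$ with $a_{ij}\ne0$ iff $(i,j)\in E(G)$. A real matrix $A$ has the nSSP if the only real $X$ with $A\circ X=O$ (entrywise product) and $AX^\top-X^\top A=O$ is $X=O$; $G$ requires the nSSP if every $A\in\mathcal M(G)$ has the nSSP. -}

module Defs where


open import Data.Nat using (ℕ; zero; suc)
open import Data.Fin using (Fin; zero; suc)
open import Data.Bool using (Bool; T)
open import Data.Product using (_×_; Σ; ∃; _,_)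
open import Data.Sum using (_⊎_)
open import Data.Empty using (⊥)
open import Relation.Nullary using (¬_)
open import Relation.Binary.PropositionalEquality using (_≡_; _≢_)

-- The real numbers, given axiomatically as a complete ordered field
-- (this axiomatisation characterises ℝ up to isomorphism).

record RealField : Set₁ where
  infixl 6 _+_
  infixl 7 _*_
  infix 4 _<_ _≤_
  field
    R    : Set
    0# 1# : R
    _+_ _*_ : R → R → R
    -_   : R → R
    _<_  : R → R → Set
    +-assoc     : ∀ x y z → (x + y) + z ≡ x + (y + z)
    +-comm      : ∀ x y → x + y ≡ y + x
    +-identityˡ : ∀ x → 0# + x ≡ x
    -‿inverseˡ  : ∀ x → (- x) + x ≡ 0#
    *-assoc     : ∀ x y z → (x * y) * z ≡ x * (y * z)
    *-comm      : ∀ x y → x * y ≡ y * x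
    *-identityˡ : ∀ x → 1# * x ≡ x
    distribˡ    : ∀ x y z → x * (y + z) ≡ (x * y) + (x * z)
    0≢1         : 0# ≢ 1#
    inverse     : ∀ x → x ≢ 0# → Σ R (λ y → x * y ≡ 1#)
    <-irrefl    : ∀ x → ¬ (x < x)
    <-trans     : ∀ x y z → x < y → y < z → x < z
    <-trichotomy : ∀ x y → x < y ⊎ (x ≡ y ⊎ y < x)
    +-mono-<    : ∀ x y z → x < y → x + z < y + z
    *-pos       : ∀ x y → 0# < x → 0# < y → 0# < x * y
  _≤_ : R → R → Set
  x ≤ y = x < y ⊎ x ≡ y
  field
    complete : (P : R → Set) → Σ R P → Σ R (λ b → ∀ x → P x → x ≤ b) →
               Σ R (λ s → (∀ x → P x → x ≤ s) ×
                          (∀ b → (∀ x → P x → x ≤ b) → s ≤ b))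

Digraph : ℕ → Set
Digraph n = Fin n → Fin n → Bool

Arc : ∀ {n} → Digraph n → Fin n → Fin n → Set
Arc G i j = T (G i j)

_⊆G_ : ∀ {n} → Digraph n → Digraph n → Set
G ⊆G H = ∀ i j → Arc G i j → Arc H i j

IsComplete : ∀ {n} → Digraph n → Set
IsComplete G = ∀ i j → Arc G i j

-- Admissibility of an arc (a , b) for H (= G_t), relative to G.
-- Type 1: arc (j,k) = (a,b): ∃ i, N⁺_G[i] ∩ (V ∖ N⁺_H[a]) = {b}
--                              and N⁻_G[a] ∩ (V ∖ N⁻_H[i]) = ∅.
AdmissibleJK : ∀ {n} → Digraph n → Digraph n → Fin n → Fin n → Set
AdmissibleJK {n} G H a b = Σ (Fin n) λ i →
  (∀ x → ((Arc G i x × ¬ Arc H a x) → x ≡ b) × (x ≡ b → (Arc G i x × ¬ Arc H a x)))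
  × (∀ x → ¬ (Arc G x a × ¬ Arc H x i))

-- Type 2: arc (m,i) = (a,b): ∃ j, N⁺_G[b] ∩ (V ∖ N⁺_H[j]) = ∅
--                              and N⁻_G[j] ∩ (V ∖ N⁻_H[b]) = {a}.
AdmissibleMI : ∀ {n} → Digraph n → Digraph n → Fin n → Fin n → Set
AdmissibleMI {n} G H a b = Σ (Fin n) λ j →
  (∀ x → ¬ (Arc G b x × ¬ Arc H j x))
  × (∀ x → ((Arc G x j × ¬ Arc H x b) → x ≡ a) × (x ≡ a → (Arc G x j × ¬ Arc H x b)))

Admissible : ∀ {n} → Digraph n → Digraph n → Fin n → Fin n → Set
Admissible G H a b = AdmissibleJK G H a b ⊎ AdmissibleMI G H a b

module _ (ℝ : RealField) where
  open RealField ℝ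

  Matrix : ℕ → Set
  Matrix n = Fin n → Fin n → R

  sumF : ∀ n → (Fin n → R) → R
  sumF zero    f = 0#
  sumF (suc n) f = f zero + sumF n (λ i → f (suc i))

  InPattern : ∀ {n} → Digraph n → Matrix n → Set
  InPattern G A = ∀ i j → (A i j ≢ 0# → Arc G i j) × (Arc G i j → A i j ≢ 0#)

  AXᵀ : ∀ {n} → Matrix n → Matrix n → Matrix n
  AXᵀ {n} A X i j = sumF n (λ k → A i k * X j k)

  XᵀA : ∀ {n} → Matrix n → Matrix n → Matrix n
  XᵀA {n} A X i j = sumF n (λ k → X k i * A k j)

  HasNSSP : ∀ {n} → Matrix n → Set
  HasNSSP {n} A = (X : Matrix n) →
    (∀ i j → A i j * X i j ≡ 0#) →
    (∀ i j → AXᵀ A X i j ≡ XᵀA A X i j) →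
    ∀ i j → X i j ≡ 0#

  RequiresNSSP : ∀ {n} → Digraph n → Set
  RequiresNSSP {n} G = (A : Matrix n) → InPattern G A → HasNSSP A

module Submission where

-- Let A ∈ 𝓜(G) and let X satisfy A ∘ X = O and A Xᵀ = Xᵀ A; we show that X
-- vanishes on every arc of every G_t, hence everywhere since G_k is complete.
-- On arcs of G it vanishes because A ∘ X = O and a_ij ≠ 0 there. For a
-- type-1 admissible arc (j,k) with witness i, the (i,j) entries of A Xᵀ and
-- Xᵀ A are Σ_l a_il x_jl and Σ_l x_li a_lj: every summand of the second, and
-- every summand but l = k of the first, has a zero factor, either because the
-- arc of A is missing from G or because the entry of X lies on an arc of G_t.
-- So a_ik x_jk = 0 with a_ik ≠ 0. Type-2 arcs are symmetric.

open import Defs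
open import Data.Nat using (ℕ; zero; suc; _<_; _≤_)
open import Data.Nat.Properties using (≤-refl; <⇒≤)
open import Data.Fin using (Fin; zero; suc)
open import Data.Fin.Properties using (suc-injective)
open import Data.Sum using (_⊎_; inj₁; inj₂)
open import Data.Product using (_×_; _,_; proj₁; proj₂)
open import Data.Bool using (T)
open import Data.Bool.Properties using (T?)
open import Data.Empty using (⊥-elim)
open import Relation.Nullary using (¬_; yes; no)
open import Relation.Binary.PropositionalEquality
  using (_≡_; _≢_; refl; sym; trans; cong; cong₂; subst; module ≡-Reasoning)

module FieldProperties (ℝ : RealField) where
  open RealField ℝ hiding (_≤_)
  open RealField ℝ using () renaming (_<_ to _<ℝ_)
  open ≡-Reasoning

  +-identityʳ : ∀ x → x + 0# ≡ x
  +-identityʳ x = trans (+-comm x 0#) (+-identityˡ x)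

  x≡x+x⇒x≡0 : ∀ x → x ≡ x + x → x ≡ 0#
  x≡x+x⇒x≡0 x e = sym (begin
    0#              ≡⟨ sym (-‿inverseˡ x) ⟩
    (- x) + x       ≡⟨ cong ((- x) +_) e ⟩
    (- x) + (x + x) ≡⟨ sym (+-assoc (- x) x x) ⟩
    ((- x) + x) + x ≡⟨ cong (_+ x) (-‿inverseˡ x) ⟩
    0# + x          ≡⟨ +-identityˡ x ⟩
    x               ∎)

  zeroʳ : ∀ x → x * 0# ≡ 0#
  zeroʳ x = x≡x+x⇒x≡0 (x * 0#)
    (trans (cong (x *_) (sym (+-identityˡ 0#))) (distribˡ x 0# 0#))

  zeroˡ : ∀ x → 0# * x ≡ 0#
  zeroˡ x = trans (*-comm 0# x) (zeroʳ x)

  x≢0∧x*y≡0⇒y≡0 : ∀ x y → x ≢ 0# → x * y ≡ 0# → y ≡ 0#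
  x≢0∧x*y≡0⇒y≡0 x y x≢0 xy≡0 with inverse x x≢0
  ... | x⁻¹ , xx⁻¹≡1 = begin
    y               ≡⟨ sym (*-identityˡ y) ⟩
    1# * y          ≡⟨ cong (_* y) (trans (sym xx⁻¹≡1) (*-comm x x⁻¹)) ⟩
    (x⁻¹ * x) * y   ≡⟨ *-assoc x⁻¹ x y ⟩
    x⁻¹ * (x * y)   ≡⟨ cong (x⁻¹ *_) xy≡0 ⟩
    x⁻¹ * 0#        ≡⟨ zeroʳ x⁻¹ ⟩
    0#              ∎

  ≡0⊎≢0 : ∀ x → x ≡ 0# ⊎ x ≢ 0#
  ≡0⊎≢0 x with <-trichotomy x 0#
  ... | inj₁ x<0        = inj₂ (λ x≡0 → <-irrefl 0# (subst (_<ℝ 0#) x≡0 x<0))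
  ... | inj₂ (inj₁ x≡0) = inj₁ x≡0
  ... | inj₂ (inj₂ 0<x) = inj₂ (λ x≡0 → <-irrefl 0# (subst (0# <ℝ_) x≡0 0<x))

  sumF-zero : ∀ n (f : Fin n → R) → (∀ l → f l ≡ 0#) → sumF ℝ n f ≡ 0#
  sumF-zero zero    f f≡0 = refl
  sumF-zero (suc n) f f≡0 =
    trans (cong₂ _+_ (f≡0 zero) (sumF-zero n (λ l → f (suc l)) (λ l → f≡0 (suc l))))
          (+-identityʳ 0#)

  sumF-single : ∀ n (f : Fin n → R) c → (∀ l → l ≢ c → f l ≡ 0#) → sumF ℝ n f ≡ f c
  sumF-single (suc n) f zero f≡0 =
    trans (cong (f zero +_) (sumF-zero n (λ l → f (suc l)) (λ l → f≡0 (suc l) (λ ()))))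
          (+-identityʳ (f zero))
  sumF-single (suc n) f (suc c) f≡0 =
    trans (cong₂ _+_ (f≡0 zero (λ ()))
                     (sumF-single n (λ l → f (suc l)) c
                        (λ l l≢c → f≡0 (suc l) (λ e → l≢c (suc-injective e)))))
          (+-identityˡ (f (suc c)))

VanishesOn : (ℝ : RealField) {n : ℕ} → Matrix ℝ n → Digraph n → Set
VanishesOn ℝ X H = ∀ a b → Arc H a b → X a b ≡ RealField.0# ℝ

module Centralizer (ℝ : RealField) {n : ℕ} (G : Digraph n) (A : Matrix ℝ n)
                   (A∈𝓜G : InPattern ℝ G A) (X : Matrix ℝ n)
                   (A∘X≡O : ∀ i j → RealField._*_ ℝ (A i j) (X i j) ≡ RealField.0# ℝ)
                   (AXᵀ≡XᵀA : ∀ i j → AXᵀ ℝ A X i j ≡ XᵀA ℝ A X i j) where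
  open RealField ℝ hiding (_<_; _≤_)
  open FieldProperties ℝ
  open ≡-Reasoning

  ¬arc⇒A≡0 : ∀ i j → ¬ Arc G i j → A i j ≡ 0#
  ¬arc⇒A≡0 i j ¬arc with ≡0⊎≢0 (A i j)
  ... | inj₁ A≡0 = A≡0
  ... | inj₂ A≢0 = ⊥-elim (¬arc (proj₁ (A∈𝓜G i j) A≢0))

  arc⇒A≢0 : ∀ i j → Arc G i j → A i j ≢ 0#
  arc⇒A≢0 i j = proj₂ (A∈𝓜G i j)

  vanishesOn-G : VanishesOn ℝ X G
  vanishesOn-G a b arc = x≢0∧x*y≡0⇒y≡0 (A a b) (X a b) (arc⇒A≢0 a b arc) (A∘X≡O a b)

  module _ {H : Digraph n} (X-vanishes : VanishesOn ℝ X H) where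

    A*X≡0 : ∀ i j a b → ¬ (Arc G i j × ¬ Arc H a b) → A i j * X a b ≡ 0#
    A*X≡0 i j a b ¬[G∖H] with T? (G i j) | T? (H a b)
    ... | no ¬g  | _      = trans (cong (_* X a b) (¬arc⇒A≡0 i j ¬g)) (zeroˡ (X a b))
    ... | yes _  | yes h  = trans (cong (A i j *_) (X-vanishes a b h)) (zeroʳ (A i j))
    ... | yes g  | no ¬h  = ⊥-elim (¬[G∖H] (g , ¬h))

    X*A≡0 : ∀ a b i j → ¬ (Arc G i j × ¬ Arc H a b) → X a b * A i j ≡ 0#
    X*A≡0 a b i j ¬[G∖H] = trans (*-comm (X a b) (A i j)) (A*X≡0 i j a b ¬[G∖H])

    admissibleJK⇒X≡0 : ∀ a b → AdmissibleJK G H a b → X a b ≡ 0#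
    admissibleJK⇒X≡0 a b (i , out-is-b , in-empty) =
      x≢0∧x*y≡0⇒y≡0 (A i b) (X a b) A-ib≢0 (begin
        A i b * X a b  ≡⟨ sym (sumF-single n (λ l → A i l * X a l) b other-terms≡0) ⟩
        AXᵀ ℝ A X i a  ≡⟨ AXᵀ≡XᵀA i a ⟩
        XᵀA ℝ A X i a  ≡⟨ sumF-zero n (λ l → X l i * A l a) (λ l → X*A≡0 l i l a (in-empty l)) ⟩
        0#             ∎)
      where
      A-ib≢0 : A i b ≢ 0#
      A-ib≢0 = arc⇒A≢0 i b (proj₁ (proj₂ (out-is-b b) refl))

      other-terms≡0 : ∀ l → l ≢ b → A i l * X a l ≡ 0#
      other-terms≡0 l l≢b = A*X≡0 i l a l (λ l∈ → l≢b (proj₁ (out-is-b l) l∈))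

    admissibleMI⇒X≡0 : ∀ a b → AdmissibleMI G H a b → X a b ≡ 0#
    admissibleMI⇒X≡0 a b (j , out-empty , in-is-a) =
      x≢0∧x*y≡0⇒y≡0 (A a j) (X a b) A-aj≢0 (trans (*-comm (A a j) (X a b)) (begin
        X a b * A a j  ≡⟨ sym (sumF-single n (λ l → X l b * A l j) a other-terms≡0) ⟩
        XᵀA ℝ A X b j  ≡⟨ sym (AXᵀ≡XᵀA b j) ⟩
        AXᵀ ℝ A X b j  ≡⟨ sumF-zero n (λ l → A b l * X j l) (λ l → A*X≡0 b l j l (out-empty l)) ⟩
        0#             ∎))
      where
      A-aj≢0 : A a j ≢ 0#
      A-aj≢0 = arc⇒A≢0 a j (proj₁ (proj₂ (in-is-a a) refl))

      other-terms≡0 : ∀ l → l ≢ a → X l b * A l j ≡ 0#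
      other-terms≡0 l l≢a = X*A≡0 l b l j (λ l∈ → l≢a (proj₁ (in-is-a l) l∈))

    admissible⇒X≡0 : ∀ a b → Admissible G H a b → X a b ≡ 0#
    admissible⇒X≡0 a b (inj₁ adm) = admissibleJK⇒X≡0 a b adm
    admissible⇒X≡0 a b (inj₂ adm) = admissibleMI⇒X≡0 a b adm

  -- The chain need not be increasing: every arc of G_{t+1} is old or admissible.
  vanishesOn-chain : ∀ k (Gs : ℕ → Digraph n) →
    (∀ i j → Gs zero i j ≡ G i j) →
    (∀ t → t < k → ∀ a b → Arc (Gs (suc t)) a b → Arc (Gs t) a b ⊎ Admissible G (Gs t) a b) →
    ∀ t → t ≤ k → VanishesOn ℝ X (Gs t)
  vanishesOn-chain k Gs Gs₀≡G step zero _ a b arc =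
    vanishesOn-G a b (subst T (Gs₀≡G a b) arc)
  vanishesOn-chain k Gs Gs₀≡G step (suc t) t<k a b arc with step t t<k a b arc
  ... | inj₁ old = vanishesOn-chain k Gs Gs₀≡G step t (<⇒≤ t<k) a b old
  ... | inj₂ adm = admissible⇒X≡0 (vanishesOn-chain k Gs Gs₀≡G step t (<⇒≤ t<k)) a b adm

theorem3p3 : (ℝ : RealField) (n : ℕ) (G : Digraph n) (k : ℕ) (Gs : ℕ → Digraph n) →
    (∀ i j → Gs zero i j ≡ G i j) →
    IsComplete (Gs k) →
    (∀ t → t < k → Gs t ⊆G Gs (suc t)) →
    (∀ t → t < k → ∀ (a b : Fin n) → Arc (Gs (suc t)) a b →
      Arc (Gs t) a b ⊎ Admissible G (Gs t) a b) →
    RequiresNSSP ℝ G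
theorem3p3 ℝ n G k Gs Gs₀≡G Gₖ-complete _ step A A∈𝓜G X A∘X≡O AXᵀ≡XᵀA i j =
  vanishesOn-chain k Gs Gs₀≡G step k ≤-refl i j (Gₖ-complete i j)
  where open Centralizer ℝ G A A∈𝓜G X A∘X≡O AXᵀ≡XᵀA
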